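{- Let $k\geq 0$, let $G$ be an oriented graph and let $S\subseteq V(G)$. Then $G$ can be derived from a Burling tree as a $k$-Burling graph with top-set $S$ if and only if $G$ is a $k$-sequential graph with base forest $H$ such that $H=G[S]$.
   Context: Rooted trees: for a rooted tree $(T,r)$ and $v\neq r$, $p(v)$ is the parent of $v$. A branch is a path $v_1v_2\dots v_k$ of $T$ with $v_i$ the parent of $v_{i+1}$ for all $i$ (it starts at $v_1$); a branch may be empty. A Burling tree is a 4-tuple $(T,r,\ell,c)$ where $T$ is a rooted tree with root $r$; $\ell$ assigns to every non-leaf vertex $v$ one of its children $\ell(v)$, the last-born of $v$; and $c$ is a function on $V(T)$ such that if $v\neq r$ is not a last-born then $c(v)$ is the vertex set of a (possibly empty) branch of $T$ starting at $\ell(p(v))$, while $c(v)=\varnothing$ if $v$ is the root or a last-born. The oriented graph fully derived from the Burling tree has vertex set $V(T)$ and an arc $uv$ iff $v\in c(u)$. An oriented graph $G$ is derived from the Burling tree if it is an induced subgraph of the fully derived oriented graph; it is derived from $T$ as a $k$-Burling graph if moreover every branch of $T$ contains at most $k$ vertices of $G$. The top-set of $G$ with respect to $T$ is the set of vertices $v$ of $G$ such that $v$ is the only vertex of $G$ on the path of $T$ from $r$ to $v$. An in-tree is an oriented graph obtained from a rooted tree by orienting every edge towards the root; an in-forest is an oriented forest whose components are in-trees (every non-sink vertex of an in-forest has exactly one out-neighbour). $k$-sequential graphs are pairs $(G,\mathcal S)$ with $G$ an oriented graph and $\mathcal S$ a set of stable sets of $G$, defined recursively: the $0$-sequential graph is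 $(G,\{\varnothing\})$ with $G$ the empty graph. For $k\geq 1$, a $k$-sequential graph is any pair $(G,\mathcal S)$ obtained as follows: pick a (possibly empty) in-forest $H$; for every vertex $v$ of $H$ pick a $(k-1)$-sequential graph $(H_v,\mathcal R_v)$ (these graphs pairwise vertex-disjoint and disjoint from $H$); take the disjoint union of $H$ and all $H_v$; then for every vertex $u$ of $H$ that is not a sink of $H$, with unique out-neighbour $v$ in $H$, choose a stable set $R\in\mathcal R_v$ and add all arcs from $u$ to the vertices of $R$; these are all vertices and arcs of $G$; finally set $\mathcal S=\{\varnothing\}\cup\{\{v\}\cup R : v\in V(H), R\in\mathcal R_v\}$. An oriented graph $G$ is $k$-sequential with base forest $H$ if some pair $(G,\mathcal S)$ is $k$-sequential and obtained by this construction with in-forest $H$. -}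

module Defs where

open import Data.Nat using (ℕ; zero; suc; _≤_; _<_)
open import Data.Fin using (Fin)
open import Data.Fin.Subset using (Subset; _∈_)
open import Data.Bool using (Bool; true; false)
open import Data.Maybe using (Maybe; just; nothing)
open import Data.List using (List; []; _∷_; length)
open import Data.List.Membership.Propositional using () renaming (_∈_ to _∈ₗ_)
open import Data.List.Relation.Unary.Unique.Propositional using (Unique)
open import Data.Product using (Σ; ∃; _×_; _,_)
open import Data.Sum using (_⊎_; inj₁; inj₂)
open import Data.Empty using (⊥)
open import Data.Unit using (⊤; tt)
open import Relation.Nullary using (¬_)
open import Relation.Binary.PropositionalEquality using (_≡_; _≢_)
open import Function.Bundles using (_⇔_; _↔_; Inverse)
open import Function.Definitions using (Injective)

record OGraph (n : ℕ) : Set where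
  field
    arc       : Fin n → Fin n → Bool
    loopless  : ∀ u → arc u u ≡ false
    asym      : ∀ u v → arc u v ≡ true → arc v u ≡ false

-- The parent of v ≠ root is `parent v` (the value at the root is
-- irrelevant); the depth function witnesses that every vertex reaches the
-- root, i.e. that the edges {v , parent v} (v ≠ root) form a tree.

record RootedTree (m : ℕ) : Set where
  field
    root         : Fin m
    parent       : Fin m → Fin m
    depth        : Fin m → ℕ
    depth-root   : depth root ≡ 0
    depth-parent : ∀ v → v ≢ root → depth v ≡ suc (depth (parent v))

module _ {m : ℕ} (T : RootedTree m) where
  open RootedTree T

  IsChild : Fin m → Fin m → Set
  IsChild w v = (w ≢ root) × (parent w ≡ v)

  NonLeaf : Fin m → Set
  NonLeaf v = ∃ λ w → IsChild w v

  data Branch : List (Fin m) → Set where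
    empty  : Branch []
    single : ∀ x → Branch (x ∷ [])
    step   : ∀ {x y bs} → IsChild y x → Branch (y ∷ bs) → Branch (x ∷ y ∷ bs)

  BranchFrom : Fin m → List (Fin m) → Set
  BranchFrom x bs = Branch bs × ((bs ≡ []) ⊎ (∃ λ t → bs ≡ x ∷ t))

  data _≼_ : Fin m → Fin m → Set where
    here : ∀ {u} → u ≼ u
    up   : ∀ {u v} → v ≢ root → u ≼ parent v → u ≼ v

-- Burling trees (T , r , ℓ , c) on the vertex set Fin m.
-- c(v) is given as the list of vertices of the branch (in order).

record BurlingTree (m : ℕ) : Set where
  field
    tree : RootedTree m
  open RootedTree tree public
  field
    last       : Fin m → Fin m
    last-child : ∀ v → NonLeaf tree v → IsChild tree (last v) v
  LastBorn : Fin m → Set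
  LastBorn v = (v ≢ root) × (last (parent v) ≡ v)
  field
    c        : Fin m → List (Fin m)
    c-root   : c root ≡ []
    c-last   : ∀ v → LastBorn v → c v ≡ []
    c-branch : ∀ v → v ≢ root → ¬ LastBorn v → BranchFrom tree (last (parent v)) (c v)

  DArc : Fin m → Fin m → Set
  DArc u v = v ∈ₗ c u

record KBurlingWithTop (k : ℕ) {n : ℕ} (G : OGraph n) (S : Subset n) : Set where
  field
    m     : ℕ
    B     : BurlingTree m
    φ     : Fin n → Fin m
    φ-inj : Injective _≡_ _≡_ φ
  open BurlingTree B
  field
    induced : ∀ u v → (OGraph.arc G u v ≡ true) ⇔ DArc (φ u) (φ v)
    bounded : ∀ bs → Branch tree bs →
              ∀ (xs : List (Fin n)) → Unique xs → (∀ x → x ∈ₗ xs → φ x ∈ₗ bs) →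
              length xs ≤ k
  IsTop : Fin n → Set
  IsTop x = ∀ y → _≼_ tree (φ y) (φ x) → y ≡ x
  field
    topset : ∀ x → (x ∈ S) ⇔ IsTop x

-- In-forests on Fin h: every vertex has at most one out-neighbour
-- (`out`), and a rank function strictly decreasing along arcs rules out
-- directed cycles (so the components are in-trees).

record InForest (h : ℕ) : Set where
  field
    out      : Fin h → Maybe (Fin h)
    rank     : Fin h → ℕ
    rank-dec : ∀ u v → out u ≡ just v → rank v < rank u

-- k-sequential constructions (G , 𝒮), by induction-recursion.
-- `Vert g` is the vertex set of the constructed graph, `Idx g` indexes the
-- family 𝒮, and `Member g i` is the stable set with index i.

mutual
  data Seq : ℕ → Set where
    seq0 : Seq 0
    seqS : ∀ {k} (h : ℕ) (H : InForest h) (sub : Fin h → Seq k)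
           (pick : (u v : Fin h) → InForest.out H u ≡ just v → Idx (sub v)) →
           Seq (suc k)

  Vert : ∀ {k} → Seq k → Set
  Vert seq0 = ⊥
  Vert (seqS h H sub pick) = Fin h ⊎ Σ (Fin h) (λ v → Vert (sub v))

  -- 𝒮 = {∅} ∪ {{v} ∪ R : v ∈ V(H), R ∈ 𝒮_v};  for k = 0, 𝒮 = {∅}
  Idx : ∀ {k} → Seq k → Set
  Idx seq0 = ⊤
  Idx (seqS h H sub pick) = ⊤ ⊎ Σ (Fin h) (λ v → Idx (sub v))

data Member : ∀ {k} (g : Seq k) → Idx g → Vert g → Set where
  top   : ∀ {k h H sub pick v i} →
          Member {suc k} (seqS h H sub pick) (inj₂ (v , i)) (inj₁ v)
  below : ∀ {k h H sub pick v i x} → Member (sub v) i x →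
          Member {suc k} (seqS h H sub pick) (inj₂ (v , i)) (inj₂ (v , x))

data Arc : ∀ {k} (g : Seq k) → Vert g → Vert g → Set where
  forest : ∀ {k h H sub pick u v} → InForest.out H u ≡ just v →
           Arc {suc k} (seqS h H sub pick) (inj₁ u) (inj₁ v)
  inside : ∀ {k h H sub pick v x y} → Arc (sub v) x y →
           Arc {suc k} (seqS h H sub pick) (inj₂ (v , x)) (inj₂ (v , y))
  cross  : ∀ {k h H sub pick u v x} (e : InForest.out H u ≡ just v) →
           Member (sub v) (pick u v e) x →
           Arc {suc k} (seqS h H sub pick) (inj₁ u) (inj₂ (v , x))

InBase : ∀ {k} (g : Seq k) → Vert g → Set
InBase seq0 ()
InBase (seqS h H sub pick) (inj₁ _) = ⊤
InBase (seqS h H sub pick) (inj₂ _) = ⊥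

-- G (on Fin n) is k-sequential with base forest H such that H = G[S]:
-- G is isomorphic (via ψ) to the graph of a k-sequential construction
-- and ψ maps S onto the vertex set of the base forest H (arcs of the
-- construction between base vertices are exactly the arcs of H).
KSequentialWithBase : (k : ℕ) {n : ℕ} (G : OGraph n) (S : Subset n) → Set
KSequentialWithBase k {n} G S =
  Σ (Seq k) λ g → Σ (Fin n ↔ Vert g) λ ψ →
    (∀ u v → (OGraph.arc G u v ≡ true) ⇔ Arc g (Inverse.to ψ u) (Inverse.to ψ v)) ×
    (∀ u → (u ∈ S) ⇔ InBase g (Inverse.to ψ u))

{-# OPTIONS --safe #-}
module Submission where

-- A k-Burling graph is peeled from the top.  Its top vertices are pairwise
-- incomparable in T, and the arcs out of a top u go into the branch c(u), which
-- meets them at most once: so they induce an in-forest H (a rank combining depth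
-- and emptiness of c decreases along arcs).  Below each top v the vertices of G
-- form a (k − 1)-Burling graph, since every branch through them also meets v, and
-- the arcs from u into the part below its out-neighbour v end exactly at the
-- vertices on the root path to the bottom of c(u), which by induction is a
-- stable set of the sequential structure below v.
-- Conversely, the Burling trees of the graphs H_v are grafted below a spine of
-- last-borns, at depths increasing along the arcs of H, so that c of the root
-- of block u can run down the spine into the block of its out-neighbour and stop
-- at the vertex representing the chosen stable set.

open import Defs
  hiding (IsChild; NonLeaf; Branch; BranchFrom; _≼_; here; up; empty; single; step)
import Defs as D
open import Data.Nat using (ℕ; zero; suc; _≤_; _<_; z≤n; s≤s; _+_; _*_; _∸_; _⊔_)
open import Data.Nat.Properties
  using ( ≤-refl; ≤-trans; ≤-antisym; <-irrefl; <⇒≤; ≤-pred; m≤n⇒m≤1+n; m≤n⇒m<n∨m≡n; suc-injective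
        ; m≤m⊔n; m≤n⊔m; ≰⇒>; _≤?_; _<?_; +-monoˡ-≤; *-monoʳ-<; ∸-monoʳ-<; ∸-monoʳ-≤; m∸n≤m; 0≢1+n; 1+n≰n )
open import Data.Nat.Induction using (<-rec)
open import Data.Fin using (Fin; zero; suc; toℕ; fromℕ; fromℕ<; inject₁) renaming (_≟_ to _≟ᶠ_)
open import Data.Fin.Properties
  using (any?; all?; +↔⊎; 1↔⊤; toℕ-inject₁; toℕ-fromℕ; toℕ-fromℕ<; toℕ-injective)
  renaming (suc-injective to fsuc-injective)
open import Data.Fin.Subset using (Subset; _∈_)
open import Data.Bool using (true)
open import Data.Maybe using (Maybe; just; nothing)
open import Data.Maybe.Properties using (just-injective)
open import Data.List using (List; []; _∷_; _++_; length; map)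
open import Data.List.Membership.Propositional using () renaming (_∈_ to _∈ₗ_)
open import Data.List.Relation.Unary.Any using (here; there)
open import Data.List.Relation.Unary.Any.Properties using (¬Any[])
open import Data.List.Relation.Unary.All using (All; tabulate; lookup; [])
open import Data.List.Relation.Unary.Unique.Propositional using (Unique)
open import Data.List.Relation.Unary.Unique.Propositional.Properties using () renaming (map⁺ to Unique-map⁺)
open import Data.List.Properties using (length-map)
open import Data.List.Relation.Unary.AllPairs using ([]; _∷_)
import Data.List.Membership.DecPropositional as DecMembership
open import Data.List.Membership.Propositional.Properties using (∈-map⁺; ∈-map⁻)
open import Data.Product using (Σ; ∃; _×_; _,_; proj₁; proj₂)
open import Data.Sum using (_⊎_; inj₁; inj₂)
open import Data.Sum.Function.Propositional using (_⊎-↔_)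
open import Data.Empty using (⊥; ⊥-elim)
open import Data.Unit using (⊤; tt)
open import Relation.Nullary using (¬_; Dec; yes; no)
open import Relation.Nullary.Decidable using (_×-dec_; _→-dec_; ¬?; map′)
open import Relation.Unary using (Decidable)
open import Relation.Binary.Definitions using (DecidableEquality)
open import Relation.Binary.PropositionalEquality using (_≡_; _≢_; refl; sym; trans; cong; subst; subst₂)
open import Axiom.UniquenessOfIdentityProofs.WithK using (uip)
open import Function.Bundles using (_⇔_; mk⇔; Equivalence; _↔_; Inverse; mk↔ₛ′)
open import Function.Properties.Inverse using (↔-refl; ↔-sym; ↔-trans)

-- Copies of RootedTree and BurlingTree over an arbitrary vertex type, so that
-- trees can be grafted together before their vertices are enumerated.
record RootedTreeOn (N : Set) : Set where
  field
    root         : N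
    parent       : N → N
    depth        : N → ℕ
    depth-root   : depth root ≡ 0
    depth-parent : ∀ v → v ≢ root → depth v ≡ suc (depth (parent v))

module Paths {N : Set} (T : RootedTreeOn N) where
  open RootedTreeOn T

  IsChild : N → N → Set
  IsChild w v = (w ≢ root) × (parent w ≡ v)

  NonLeaf : N → Set
  NonLeaf v = ∃ λ w → IsChild w v

  data Branch : List N → Set where
    empty  : Branch []
    single : ∀ x → Branch (x ∷ [])
    step   : ∀ {x y bs} → IsChild y x → Branch (y ∷ bs) → Branch (x ∷ y ∷ bs)

  BranchFrom : N → List N → Set
  BranchFrom x bs = Branch bs × ((bs ≡ []) ⊎ (∃ λ t → bs ≡ x ∷ t))

  infix 4 _≼_
  data _≼_ : N → N → Set where
    here : ∀ {u} → u ≼ u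
    up   : ∀ {u v} → v ≢ root → u ≼ parent v → u ≼ v

record BurlingTreeOn (N : Set) : Set where
  field
    tree : RootedTreeOn N
  open RootedTreeOn tree public
  open Paths tree public
  field
    last       : N → N
    last-child : ∀ v → NonLeaf v → IsChild (last v) v
  LastBorn : N → Set
  LastBorn v = (v ≢ root) × (last (parent v) ≡ v)
  field
    c        : N → List N
    c-root   : c root ≡ []
    c-last   : ∀ v → LastBorn v → c v ≡ []
    c-branch : ∀ v → v ≢ root → ¬ LastBorn v → BranchFrom (last (parent v)) (c v)

lastOf : {A : Set} → A → List A → A
lastOf x [] = x
lastOf x (y ∷ ys) = lastOf y ys

lastOf-∷ʳ : ∀ {A : Set} (s : A) r y → lastOf s (r ++ y ∷ []) ≡ y
lastOf-∷ʳ s [] y = refl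
lastOf-∷ʳ s (x ∷ r) y = lastOf-∷ʳ x r y

module RootedTreeProperties {N : Set} (T : RootedTreeOn N) (_≟_ : DecidableEquality N) where
  open RootedTreeOn T
  open Paths T

  ≼-trans : ∀ {u v w} → u ≼ v → v ≼ w → u ≼ w
  ≼-trans p here = p
  ≼-trans p (up ne q) = up ne (≼-trans p q)

  child⇒≼ : ∀ {x y} → IsChild y x → x ≼ y
  child⇒≼ (ne , refl) = up ne here

  parent-≼ : ∀ {v} → v ≢ root → parent v ≼ v
  parent-≼ ne = up ne here

  depth-child : ∀ {x y} → IsChild y x → depth y ≡ suc (depth x)
  depth-child {y = y} (ne , refl) = depth-parent y ne

  ≼-depth : ∀ {u v} → u ≼ v → u ≡ v ⊎ depth u < depth v
  ≼-depth here = inj₁ refl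
  ≼-depth {u} {v} (up ne p) rewrite depth-parent v ne with ≼-depth p
  ... | inj₁ refl = inj₂ ≤-refl
  ... | inj₂ q = inj₂ (m≤n⇒m≤1+n q)

  ≼-depth-≤ : ∀ {u v} → u ≼ v → depth u ≤ depth v
  ≼-depth-≤ p with ≼-depth p
  ... | inj₁ refl = ≤-refl
  ... | inj₂ q = <⇒≤ q

  ≼-depth-≡ : ∀ {u v} → u ≼ v → depth u ≡ depth v → u ≡ v
  ≼-depth-≡ p e with ≼-depth p
  ... | inj₁ e′ = e′
  ... | inj₂ r = ⊥-elim (<-irrefl e r)

  ≼-antisym : ∀ {u v} → u ≼ v → v ≼ u → u ≡ v
  ≼-antisym p q = ≼-depth-≡ p (≤-antisym (≼-depth-≤ p) (≼-depth-≤ q))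

  ≼-uncons : ∀ {u v} → u ≼ v → u ≡ v ⊎ (v ≢ root × u ≼ parent v)
  ≼-uncons here = inj₁ refl
  ≼-uncons (up ne p) = inj₂ (ne , p)

  ≼-root : ∀ {u} → u ≼ root → u ≡ root
  ≼-root here = refl
  ≼-root (up ne p) = ⊥-elim (ne refl)

  ≼-comparable : ∀ {u v x} → u ≼ x → v ≼ x → u ≼ v ⊎ v ≼ u
  ≼-comparable here q = inj₂ q
  ≼-comparable (up ne p) here = inj₁ (up ne p)
  ≼-comparable (up ne p) (up _ q) = ≼-comparable p q

  private
    depth≢0 : ∀ {v} → v ≢ root → depth v ≢ zero
    depth≢0 {v} ne e with trans (sym (depth-parent v ne)) e
    ... | ()

    root-≼-at : ∀ d v → depth v ≡ d → root ≼ v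
    root-≼-at d v e with v ≟ root
    ... | yes refl = here
    root-≼-at zero v e | no ne = ⊥-elim (depth≢0 ne e)
    root-≼-at (suc d) v e | no ne =
      up ne (root-≼-at d (parent v) (suc-injective (trans (sym (depth-parent v ne)) e)))

  root-≼ : ∀ v → root ≼ v
  root-≼ v = root-≼-at _ v refl

  private
    ≼?-at : ∀ d u v → depth v ≡ d → Dec (u ≼ v)
    ≼?-at d u v e with u ≟ v
    ... | yes refl = yes here
    ... | no u≢v with v ≟ root
    ... | yes refl = no (λ p → u≢v (≼-root p))
    ≼?-at zero u v e | no _ | no ne = ⊥-elim (depth≢0 ne e)
    ≼?-at (suc d) u v e | no u≢v | no ne =
      map′ (up ne) below-parent (≼?-at d u (parent v) (suc-injective (trans (sym (depth-parent v ne)) e)))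
      where
      below-parent : u ≼ v → u ≼ parent v
      below-parent q with ≼-uncons q
      ... | inj₁ e′ = ⊥-elim (u≢v e′)
      ... | inj₂ (_ , r) = r

  _≼?_ : ∀ u v → Dec (u ≼ v)
  u ≼? v = ≼?-at (depth v) u v refl

  branch-∈⇒between : ∀ {s r y} → Branch (s ∷ r) → y ∈ₗ s ∷ r → s ≼ y × y ≼ lastOf s r
  branch-∈⇒between (single x) (here refl) = here , here
  branch-∈⇒between (step ch b) (here refl) = here , ≼-trans (child⇒≼ ch) (proj₂ (branch-∈⇒between b (here refl)))
  branch-∈⇒between (step ch b) (there p) with branch-∈⇒between b p
  ... | a , z = ≼-trans (child⇒≼ ch) a , z

  between⇒branch-∈ : ∀ {s r y} → Branch (s ∷ r) → s ≼ y → y ≼ lastOf s r → y ∈ₗ s ∷ r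
  between⇒branch-∈ (single x) p q = here (sym (≼-antisym p q))
  between⇒branch-∈ {s} {y = y} (step ch b) p q with y ≟ s
  ... | yes e = here e
  ... | no ne with ≼-comparable (proj₂ (branch-∈⇒between b (here refl))) q
  ... | inj₁ y′≼y = there (between⇒branch-∈ b y′≼y q)
  ... | inj₂ y≼y′ with ≼-uncons y≼y′
  ...   | inj₁ refl = there (here refl)
  ...   | inj₂ (_ , r) rewrite proj₂ ch = ⊥-elim (ne (≼-antisym r p))

  branch-∷ʳ : ∀ {s r y} → Branch (s ∷ r) → IsChild y (lastOf s r) → Branch (s ∷ r ++ y ∷ [])
  branch-∷ʳ (single x) ch = step ch (single _)
  branch-∷ʳ (step ch′ b) ch = step ch′ (branch-∷ʳ b ch)

  ≼⇒branch : ∀ {s t} → s ≼ t → Σ (List N) λ r → Branch (s ∷ r) × lastOf s r ≡ t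
  ≼⇒branch here = [] , single _ , refl
  ≼⇒branch {s} {t} (up ne p) with ≼⇒branch p
  ... | r , b , e = r ++ t ∷ [] , branch-∷ʳ b (subst (IsChild t) (sym e) (ne , refl)) , lastOf-∷ʳ s r t

module BurlingTreeProperties {N : Set} (B : BurlingTreeOn N) (_≟_ : DecidableEquality N) where
  open BurlingTreeOn B
  open RootedTreeProperties tree _≟_ public

  _LastBorn? : ∀ u → Dec (LastBorn u)
  u LastBorn? with u ≟ root | last (parent u) ≟ u
  ... | yes r | _ = no λ q → proj₁ q r
  ... | no nr | yes e = yes (nr , e)
  ... | no nr | no ne = no λ q → ne (proj₂ q)

  record HasOutArc (u : N) : Set where
    field
      u≢root       : u ≢ root
      not-lastBorn : ¬ LastBorn u
      rest         : List N
      c≡           : c u ≡ last (parent u) ∷ rest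
      c-is-branch  : Branch (last (parent u) ∷ rest)
      sibling      : IsChild (last (parent u)) (parent u)

    sibling-lastBorn : LastBorn (last (parent u))
    sibling-lastBorn = proj₁ sibling , cong last (proj₂ sibling)

    sibling-depth : depth (last (parent u)) ≡ depth u
    sibling-depth = trans (depth-child sibling) (sym (depth-parent u u≢root))

  hasOutArc : ∀ {u y} → y ∈ₗ c u → HasOutArc u
  hasOutArc {u} {y} y∈ with u ≟ root
  ... | yes refl = ⊥-elim (¬Any[] (subst (y ∈ₗ_) c-root y∈))
  ... | no nr with u LastBorn?
  ... | yes lb = ⊥-elim (¬Any[] (subst (y ∈ₗ_) (c-last u lb) y∈))
  ... | no nlb with c-branch u nr nlb
  ... | b , inj₁ e = ⊥-elim (¬Any[] (subst (y ∈ₗ_) e y∈))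
  ... | b , inj₂ (r , e) = record
    { u≢root = nr ; not-lastBorn = nlb ; rest = r ; c≡ = e ; c-is-branch = subst Branch e b
    ; sibling = last-child (parent u) (u , nr , refl) }

  bottom : List N → N
  bottom [] = root
  bottom (x ∷ r) = lastOf x r

  ∈c⇒between : ∀ {u y} → y ∈ₗ c u → last (parent u) ≼ y × y ≼ bottom (c u)
  ∈c⇒between {u} {y} y∈ = subst (λ l → last (parent u) ≼ y × y ≼ bottom l) (sym c≡)
    (branch-∈⇒between c-is-branch (subst (y ∈ₗ_) c≡ y∈))
    where open HasOutArc (hasOutArc y∈)

  between⇒∈c : ∀ {u y z} → y ∈ₗ c u → last (parent u) ≼ z → z ≼ bottom (c u) → z ∈ₗ c u
  between⇒∈c {u} {y} {z} y∈ p q = subst (z ∈ₗ_) (sym c≡)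
    (between⇒branch-∈ c-is-branch p (subst (λ l → z ≼ bottom l) c≡ q))
    where open HasOutArc (hasOutArc y∈)

  ∈c⇒strictly-below-parent : ∀ {u y} → y ∈ₗ c u → parent u ≼ y × parent u ≢ y
  ∈c⇒strictly-below-parent {u} {y} y∈ = ≼-trans (child⇒≼ sibling) s≼y , p≢y
    where
    open HasOutArc (hasOutArc y∈)
    s≼y : last (parent u) ≼ y
    s≼y = proj₁ (∈c⇒between y∈)
    p≢y : parent u ≢ y
    p≢y refl = 1+n≰n (subst (_≤ depth (parent u)) (depth-child sibling) (≼-depth-≤ s≼y))

Finite : Set → Set
Finite A = Σ ℕ λ size → A ↔ Fin size

finite-Fin : ∀ n → Finite (Fin n)
finite-Fin n = n , ↔-refl

finite-⊤ : Finite ⊤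
finite-⊤ = 1 , ↔-sym 1↔⊤

finite-⊎ : ∀ {A B} → Finite A → Finite B → Finite (A ⊎ B)
finite-⊎ (a , A↔) (b , B↔) = a + b , ↔-trans (A↔ ⊎-↔ B↔) (↔-sym (+↔⊎ {a} {b}))

finite-↔ : ∀ {A B} → B ↔ A → Finite A → Finite B
finite-↔ B↔A (n , A↔) = n , ↔-trans B↔A A↔

finite-Σ : ∀ h (F : Fin h → Set) → (∀ w → Finite (F w)) → Finite (Σ (Fin h) F)
finite-Σ zero F _ = 0 , mk↔ₛ′ (λ ()) (λ ()) (λ ()) (λ { (() , _) })
finite-Σ (suc h) F fin = finite-↔ split
  (finite-⊎ (fin zero) (finite-Σ h (λ w → F (suc w)) (λ w → fin (suc w))))
  where
  split : Σ (Fin (suc h)) F ↔ (F zero ⊎ Σ (Fin h) (λ w → F (suc w)))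
  split = mk↔ₛ′ (λ { (zero , x) → inj₁ x ; (suc w , x) → inj₂ (w , x) })
                (λ { (inj₁ x) → zero , x ; (inj₂ (w , x)) → suc w , x })
                (λ { (inj₁ x) → refl ; (inj₂ (w , x)) → refl })
                (λ { (zero , x) → refl ; (suc w , x) → refl })

↔-injective : ∀ {A B : Set} (ι : A ↔ B) {x y} → Inverse.to ι x ≡ Inverse.to ι y → x ≡ y
↔-injective ι {x} {y} e = trans (sym (strictlyInverseʳ x)) (trans (cong from e) (strictlyInverseʳ y))
  where open Inverse ι

finite⇒decEq : ∀ {A} → Finite A → DecidableEquality A
finite⇒decEq (_ , ι) x y = map′ (↔-injective ι) (cong (Inverse.to ι)) (Inverse.to ι x ≟ᶠ Inverse.to ι y)

record Enumeration {n : ℕ} (P : Fin n → Set) : Set where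
  field
    count          : ℕ
    enum           : Fin count → Fin n
    enum-injective : ∀ i j → enum i ≡ enum j → i ≡ j
    enum-P         : ∀ i → P (enum i)
    enum-onto      : ∀ x → P x → Σ (Fin count) λ i → enum i ≡ x

enumerate : ∀ {n} {P : Fin n → Set} → Decidable P → Enumeration P
enumerate {zero} P? = record
  { count = 0 ; enum = λ () ; enum-injective = λ () ; enum-P = λ () ; enum-onto = λ () }
enumerate {suc n} {P} P? with enumerate (λ x → P? (suc x)) | P? zero
... | E | yes p0 = record
  { count = suc count ; enum = enum′ ; enum-injective = injective′ ; enum-P = P′ ; enum-onto = onto′ }
  where
  open Enumeration E
  enum′ : Fin (suc count) → Fin (suc n)
  enum′ zero = zero
  enum′ (suc i) = suc (enum i)
  injective′ : ∀ i j → enum′ i ≡ enum′ j → i ≡ j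
  injective′ zero zero _ = refl
  injective′ (suc i) (suc j) q = cong suc (enum-injective i j (fsuc-injective q))
  P′ : ∀ i → P (enum′ i)
  P′ zero = p0
  P′ (suc i) = enum-P i
  onto′ : ∀ x → P x → Σ (Fin (suc count)) λ i → enum′ i ≡ x
  onto′ zero _ = zero , refl
  onto′ (suc x) px with enum-onto x px
  ... | i , q = suc i , cong suc q
... | E | no ¬p0 = record
  { count = count ; enum = λ i → suc (enum i) ; enum-P = enum-P ; enum-onto = onto′
  ; enum-injective = λ i j q → enum-injective i j (fsuc-injective q) }
  where
  open Enumeration E
  onto′ : ∀ x → P x → Σ (Fin count) λ i → suc (enum i) ≡ x
  onto′ zero px = ⊥-elim (¬p0 px)
  onto′ (suc x) px with enum-onto x px
  ... | i , q = i , cong suc q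

maximum : ∀ {n} → (Fin n → ℕ) → ℕ
maximum {zero} f = 0
maximum {suc n} f = f zero ⊔ maximum (λ i → f (suc i))

≤-maximum : ∀ {n} (f : Fin n → ℕ) i → f i ≤ maximum f
≤-maximum f zero = m≤m⊔n (f zero) _
≤-maximum f (suc i) = ≤-trans (≤-maximum (λ j → f (suc j)) i) (m≤n⊔m (f zero) _)

argmin : ∀ {n} {P : Fin n → Set} → Decidable P → (f : Fin n → ℕ) → ∃ P →
         Σ (Fin n) λ y → P y × (∀ z → P z → f y ≤ f z)
argmin {n} {P} P? f (x , px) = <-rec Goal search (f x) x refl px
  where
  Goal : ℕ → Set
  Goal d = ∀ x → f x ≡ d → P x → Σ (Fin n) λ y → P y × (∀ z → P z → f y ≤ f z)
  search : ∀ d → (∀ {d′} → d′ < d → Goal d′) → Goal d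
  search d rec x refl px with any? (λ z → P? z ×-dec (f z <? f x))
  ... | yes (z , pz , lt) = rec lt z refl pz
  ... | no none = x , px , λ z pz → minimal z pz
    where
    minimal : ∀ z → P z → f x ≤ f z
    minimal z pz with f x ≤? f z
    ... | yes q = q
    ... | no nq = ⊥-elim (none (z , pz , ≰⇒> nq))

module FromFin {m : ℕ} (B : BurlingTree m) where
  open BurlingTree B using (tree; root; parent; depth; depth-root; depth-parent; last; last-child; c; c-root; c-last; c-branch)

  rootedTree : RootedTreeOn (Fin m)
  rootedTree = record
    { root = root ; parent = parent ; depth = depth ; depth-root = depth-root ; depth-parent = depth-parent }

  open Paths rootedTree

  branch⇒ : ∀ {bs} → D.Branch tree bs → Branch bs
  branch⇒ D.empty = empty
  branch⇒ (D.single x) = single x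
  branch⇒ (D.step ch b) = step ch (branch⇒ b)

  branch⇐ : ∀ {bs} → Branch bs → D.Branch tree bs
  branch⇐ empty = D.empty
  branch⇐ (single x) = D.single x
  branch⇐ (step ch b) = D.step ch (branch⇐ b)

  ≼⇒ : ∀ {u v} → D._≼_ tree u v → u ≼ v
  ≼⇒ D.here = here
  ≼⇒ (D.up ne p) = up ne (≼⇒ p)

  ≼⇐ : ∀ {u v} → u ≼ v → D._≼_ tree u v
  ≼⇐ here = D.here
  ≼⇐ (up ne p) = D.up ne (≼⇐ p)

  burlingTree : BurlingTreeOn (Fin m)
  burlingTree = record
    { tree = rootedTree ; last = last ; last-child = last-child
    ; c = c ; c-root = c-root ; c-last = c-last
    ; c-branch = λ v ne nlb → let (b , e) = c-branch v ne nlb in branch⇒ b , e }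

module ToFin {N : Set} (fin : Finite N) (B : BurlingTreeOn N) where
  open BurlingTreeOn B
  size : ℕ
  size = proj₁ fin
  open Inverse (proj₂ fin) public using (to; from; strictlyInverseˡ; strictlyInverseʳ)

  to-injective : ∀ {x y} → to x ≡ to y → x ≡ y
  to-injective = ↔-injective (proj₂ fin)

  rootedTree : RootedTree size
  rootedTree = record
    { root = to root
    ; parent = λ i → to (parent (from i))
    ; depth = λ i → depth (from i)
    ; depth-root = trans (cong depth (strictlyInverseʳ root)) depth-root
    ; depth-parent = λ i ne → trans (depth-parent (from i) (λ e → ne (from-root e)))
                                     (cong (λ z → suc (depth z)) (sym (strictlyInverseʳ _)))
    }
    where
    from-root : ∀ {i} → from i ≡ root → i ≡ to root
    from-root {i} e = trans (sym (strictlyInverseˡ i)) (cong to e)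

  child⇐ : ∀ {x y} → IsChild y x → D.IsChild rootedTree (to y) (to x)
  child⇐ {x} {y} (ne , e) = (λ q → ne (to-injective q)) , cong to (trans (cong parent (strictlyInverseʳ y)) e)

  child⇒ : ∀ {i j} → D.IsChild rootedTree j i → IsChild (from j) (from i)
  child⇒ {i} {j} (ne , e) = (λ q → ne (trans (sym (strictlyInverseˡ j)) (cong to q))) ,
                             trans (sym (strictlyInverseʳ _)) (cong from e)

  branch⇐ : ∀ {bs} → Branch bs → D.Branch rootedTree (map to bs)
  branch⇐ empty = D.empty
  branch⇐ (single x) = D.single _
  branch⇐ (step ch b) = D.step (child⇐ ch) (branch⇐ b)

  ≼⇒ : ∀ {i j} → D._≼_ rootedTree i j → from i ≼ from j
  ≼⇒ D.here = here
  ≼⇒ (D.up ne p) = up (λ q → ne (trans (sym (strictlyInverseˡ _)) (cong to q)))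
                      (subst (_ ≼_) (strictlyInverseʳ _) (≼⇒ p))

  ≼⇐ : ∀ {x y} → x ≼ y → D._≼_ rootedTree (to x) (to y)
  ≼⇐ here = D.here
  ≼⇐ {x} {y} (up ne p) = D.up (λ q → ne (to-injective q))
    (subst (D._≼_ rootedTree (to x)) (cong (λ z → to (parent z)) (sym (strictlyInverseʳ y))) (≼⇐ p))

  last-to : ∀ x → to (last (from (to x))) ≡ to (last x)
  last-to x = cong (λ z → to (last z)) (strictlyInverseʳ x)

  burlingTree : BurlingTree size
  burlingTree = record
    { tree = rootedTree
    ; last = λ i → to (last (from i))
    ; last-child = lastChild
    ; c = λ i → map to (c (from i))
    ; c-root = cong (map to) (trans (cong c (strictlyInverseʳ root)) c-root)
    ; c-last = λ i lb → cong (map to) (c-last (from i) (lastBorn⇒ lb))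
    ; c-branch = cBranch
    }
    where
    lastChild : ∀ v → D.NonLeaf rootedTree v → D.IsChild rootedTree (to (last (from v))) v
    lastChild v (w , w-child) = subst (D.IsChild rootedTree _) (strictlyInverseˡ v)
      (child⇐ (last-child (from v) (from w , child⇒ w-child)))
    lastBorn⇒ : ∀ {i} → (i ≢ to root) × (to (last (from (to (parent (from i))))) ≡ i) → LastBorn (from i)
    lastBorn⇒ {i} (ne , e) = (λ q → ne (trans (sym (strictlyInverseˡ i)) (cong to q))) ,
      trans (sym (strictlyInverseʳ _)) (cong from (trans (sym (last-to _)) e))
    cBranch : ∀ v → v ≢ to root → ¬ ((v ≢ to root) × (to (last (from (to (parent (from v))))) ≡ v)) →
              D.BranchFrom rootedTree (to (last (from (to (parent (from v)))))) (map to (c (from v)))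
    cBranch v ne nlb with c-branch (from v) (λ q → ne (trans (sym (strictlyInverseˡ v)) (cong to q)))
                                   (λ lb → nlb (ne , trans (last-to _) (trans (cong to (proj₂ lb)) (strictlyInverseˡ v))))
    ... | b , inj₁ e = branch⇐ b , inj₁ (cong (map to) e)
    ... | b , inj₂ (t , e) = branch⇐ b , inj₂ (map to t , trans (cong (map to) e) (cong (_∷ map to t) (sym (last-to _))))

  arc⇐ : ∀ {x y} → y ∈ₗ c x → to y ∈ₗ BurlingTree.c burlingTree (to x)
  arc⇐ {x} {y} y∈ = ∈-map⁺ to (subst (λ z → y ∈ₗ c z) (sym (strictlyInverseʳ x)) y∈)

  arc⇒ : ∀ {x y} → to y ∈ₗ BurlingTree.c burlingTree (to x) → y ∈ₗ c x
  arc⇒ {x} {y} y∈ with ∈-map⁻ to y∈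
  ... | z , z∈ , e = subst₂ (λ w v → w ∈ₗ c v) (to-injective (sym e)) (strictlyInverseʳ x) z∈

-- From k-Burling graphs to k-sequential graphs

module BurlingToSequential {m : ℕ} (B : BurlingTreeOn (Fin m)) {n : ℕ} (φ : Fin n → Fin m)
                           (φ-injective : ∀ {x y} → φ x ≡ φ y → x ≡ y) where
  open BurlingTreeOn B
  open BurlingTreeProperties B _≟ᶠ_
  open DecMembership (_≟ᶠ_ {m}) using (_∈?_)

  infix 4 _≺_
  _≺_ : Fin m → Fin m → Set
  u ≺ v = u ≼ v × u ≢ v

  ≺-≼-trans : ∀ {a b d} → a ≺ b → b ≼ d → a ≺ d
  ≺-≼-trans (p , ne) q = ≼-trans p q , λ { refl → ne (≼-antisym p q) }

  InCone : Maybe (Fin m) → Fin n → Set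
  InCone nothing x = ⊤
  InCone (just a) x = a ≺ φ x

  InCone? : ∀ a → Decidable (InCone a)
  InCone? nothing x = yes tt
  InCone? (just a) x = (a ≼? φ x) ×-dec ¬? (a ≟ᶠ φ x)

  InCone-≼ : ∀ {a y x} → InCone a y → φ y ≼ φ x → InCone a x
  InCone-≼ {nothing} _ _ = tt
  InCone-≼ {just a} a≺y y≼x = ≺-≼-trans a≺y y≼x

  Topmost : Maybe (Fin m) → Fin n → Set
  Topmost a x = InCone a x × (∀ y → InCone a y → φ y ≼ φ x → y ≡ x)

  Topmost? : ∀ a → Decidable (Topmost a)
  Topmost? a x = InCone? a x ×-dec all? (λ y → InCone? a y →-dec ((φ y ≼? φ x) →-dec (y ≟ᶠ x)))

  comparable-tops : ∀ {a x y} → Topmost a x → Topmost a y → φ x ≼ φ y ⊎ φ y ≼ φ x → x ≡ y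
  comparable-tops tx ty (inj₁ p) = proj₂ ty _ (proj₁ tx) p
  comparable-tops tx ty (inj₂ p) = sym (proj₂ tx _ (proj₁ ty) p)

  top-not-below : ∀ {a x y} → Topmost a x → InCone a y → ¬ φ y ≺ φ x
  top-not-below tx cy (p , ne) = ne (cong φ (proj₂ tx _ cy p))

  topmost-above : ∀ a t x → InCone a x → φ x ≼ t → Σ (Fin n) λ y → Topmost a y × φ y ≼ t
  topmost-above a t x cx x≼t with argmin (λ z → InCone? a z ×-dec (φ z ≼? t)) (λ z → depth (φ z)) (x , cx , x≼t)
  ... | y , (cy , y≼t) , shallowest = y , (cy , highest) , y≼t
    where
    highest : ∀ z → InCone a z → φ z ≼ φ y → z ≡ y
    highest z cz z≼y = φ-injective
      (≼-depth-≡ z≼y (≤-antisym (≼-depth-≤ z≼y) (shallowest z (cz , ≼-trans z≼y y≼t))))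

  ConeBounded : Maybe (Fin m) → ℕ → Set
  ConeBounded a k = ∀ t (xs : List (Fin n)) → Unique xs →
                    (∀ x → x ∈ₗ xs → InCone a x × φ x ≼ t) → length xs ≤ k

  record Realises {k} (a : Maybe (Fin m)) (g : Seq k) : Set where
    field
      emb           : Vert g → Fin n
      emb-injective : ∀ p q → emb p ≡ emb q → p ≡ q
      emb-cone      : ∀ p → InCone a (emb p)
      emb-onto      : ∀ x → InCone a x → Σ (Vert g) λ p → emb p ≡ x
      arcs          : ∀ p q → Arc g p q ⇔ (φ (emb q) ∈ₗ c (φ (emb p)))
      base          : ∀ p → InBase g p ⇔ Topmost a (emb p)
      members       : ∀ t → Σ (Idx g) λ i → ∀ p → Member g i p ⇔ (φ (emb p) ≼ t)

  nonempty : List (Fin m) → ℕ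
  nonempty [] = 0
  nonempty (_ ∷ _) = 1

  nonempty≤1 : ∀ l → nonempty l ≤ 1
  nonempty≤1 [] = z≤n
  nonempty≤1 (_ ∷ _) = ≤-refl

  height : Fin m → ℕ
  height x = maximum depth ∸ depth x

  module Extend (k : ℕ) (a : Maybe (Fin m)) (bounded : ConeBounded a (suc k))
                (realise-below : ∀ b → ConeBounded b k → Σ (Seq k) (Realises b)) where
    open Enumeration (enumerate (Topmost? a)) renaming (count to h)

    peak : Fin h → Fin n
    peak = enum

    below-peak-bounded : ∀ i → ConeBounded (just (φ (peak i))) k
    below-peak-bounded i t [] _ _ = z≤n
    below-peak-bounded i t (x ∷ xs) u under = ≤-pred (bounded t (peak i ∷ x ∷ xs) (peak∉ ∷ u) with-peak)
      where
      peak∉ : All (peak i ≢_) (x ∷ xs)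
      peak∉ = tabulate λ {y} y∈ e → proj₂ (proj₁ (under y y∈)) (cong φ e)
      with-peak : ∀ y → y ∈ₗ peak i ∷ x ∷ xs → InCone a y × φ y ≼ t
      with-peak y (here refl) =
        proj₁ (enum-P i) , ≼-trans (proj₁ (proj₁ (under x (here refl)))) (proj₂ (under x (here refl)))
      with-peak y (there y∈) = InCone-≼ (proj₁ (enum-P i)) (proj₁ (proj₁ (under y y∈))) , proj₂ (under y y∈)

    sub : Fin h → Seq k
    sub i = proj₁ (realise-below (just (φ (peak i))) (below-peak-bounded i))

    module Sub (i : Fin h) = Realises (proj₂ (realise-below (just (φ (peak i))) (below-peak-bounded i)))

    Links : Fin h → Fin h → Set
    Links i j = φ (peak j) ∈ₗ c (φ (peak i))

    links-unique : ∀ i j j′ → Links i j → Links i j′ → j ≡ j′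
    links-unique i j j′ p q = enum-injective j j′
      (comparable-tops (enum-P j) (enum-P j′) (≼-comparable (proj₂ (∈c⇒between p)) (proj₂ (∈c⇒between q))))

    out : Fin h → Maybe (Fin h)
    out i with any? (λ j → φ (peak j) ∈? c (φ (peak i)))
    ... | yes (j , _) = just j
    ... | no _ = nothing

    out⇒links : ∀ i j → out i ≡ just j → Links i j
    out⇒links i j eq with any? (λ j → φ (peak j) ∈? c (φ (peak i)))
    out⇒links i j refl | yes (.j , p) = p

    links⇒out : ∀ i j → Links i j → out i ≡ just j
    links⇒out i j q with any? (λ j → φ (peak j) ∈? c (φ (peak i)))
    ... | yes (j′ , p) = cong just (links-unique i j′ j p q)
    ... | no none = ⊥-elim (none (j , q))

    -- Along a link i → j, either φ (peak j) is the last-born sibling ℓ(p(φ (peak i)))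
    -- (same depth, and c is empty there) or it is strictly deeper.
    rank : Fin h → ℕ
    rank i = nonempty (c (φ (peak i))) + 2 * height (φ (peak i))

    rank-dec : ∀ i j → out i ≡ just j → rank j < rank i
    rank-dec i j eq with out⇒links i j eq
    ... | link = subst (λ b → rank j < b + 2 * height (φ (peak i))) (sym c-nonempty)
                       (by-depth (≼-depth (proj₁ (∈c⇒between link))))
      where
      open HasOutArc (hasOutArc link)
      c-nonempty : nonempty (c (φ (peak i))) ≡ 1
      c-nonempty = cong nonempty c≡
      by-depth : last (parent (φ (peak i))) ≡ φ (peak j) ⊎ depth (last (parent (φ (peak i)))) < depth (φ (peak j)) →
                 rank j < 1 + 2 * height (φ (peak i))
      by-depth (inj₁ s≡) rewrite sym s≡ | c-last _ sibling-lastBorn | sibling-depth = ≤-refl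
      by-depth (inj₂ deeper) = s≤s (≤-trans (+-monoˡ-≤ _ (nonempty≤1 (c (φ (peak j)))))
        (*-monoʳ-< 2 (∸-monoʳ-< (subst (_< depth (φ (peak j))) sibling-depth deeper) (≤-maximum depth (φ (peak j))))))

    H : InForest h
    H = record { out = out ; rank = rank ; rank-dec = rank-dec }

    -- The arcs from peak i into the cone of peak j end exactly at the vertices
    -- on the root path to the bottom of c (φ (peak i)).
    pick : (i j : Fin h) → out i ≡ just j → Idx (sub j)
    pick i j _ = proj₁ (Sub.members j (bottom (c (φ (peak i)))))

    g : Seq (suc k)
    g = seqS h H sub pick

    emb : Vert g → Fin n
    emb (inj₁ i) = peak i
    emb (inj₂ (j , p)) = Sub.emb j p

    emb-cone : ∀ p → InCone a (emb p)
    emb-cone (inj₁ i) = proj₁ (enum-P i)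
    emb-cone (inj₂ (j , p)) = InCone-≼ (proj₁ (enum-P j)) (proj₁ (Sub.emb-cone j p))

    peak≢sub : ∀ i j p → peak i ≢ Sub.emb j p
    peak≢sub i j p q = top-not-below (enum-P i) (proj₁ (enum-P j))
                         (subst (λ w → φ (peak j) ≺ φ w) (sym q) (Sub.emb-cone j p))

    emb-injective : ∀ p q → emb p ≡ emb q → p ≡ q
    emb-injective (inj₁ i) (inj₁ i′) q = cong inj₁ (enum-injective i i′ q)
    emb-injective (inj₁ i) (inj₂ (j , p)) q = ⊥-elim (peak≢sub i j p q)
    emb-injective (inj₂ (j , p)) (inj₁ i) q = ⊥-elim (peak≢sub i j p (sym q))
    emb-injective (inj₂ (j , p)) (inj₂ (j′ , p′)) q
      with enum-injective j j′ (comparable-tops (enum-P j) (enum-P j′)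
             (≼-comparable (proj₁ (Sub.emb-cone j p)) (subst (λ w → φ (peak j′) ≼ φ w) (sym q) (proj₁ (Sub.emb-cone j′ p′)))))
    ... | refl = cong (λ w → inj₂ (j , w)) (Sub.emb-injective j p p′ q)

    emb-onto : ∀ x → InCone a x → Σ (Vert g) λ p → emb p ≡ x
    emb-onto x cx with Topmost? a x
    ... | yes tx = inj₁ (proj₁ (enum-onto x tx)) , proj₂ (enum-onto x tx)
    ... | no ¬tx with topmost-above a (φ x) x cx here
    ... | y , ty , y≼x with enum-onto y ty
    ... | i , refl = inj₂ (i , proj₁ below-i) , proj₂ below-i
      where
      ne : φ (peak i) ≢ φ x
      ne eq with φ-injective eq
      ... | refl = ¬tx ty
      below-i : Σ (Vert (sub i)) λ p → Sub.emb i p ≡ x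
      below-i = Sub.emb-onto i x (y≼x , ne)

    peak≼parent : ∀ j p → φ (peak j) ≼ parent (φ (Sub.emb j p))
    peak≼parent j p with ≼-uncons (proj₁ (Sub.emb-cone j p))
    ... | inj₁ eq = ⊥-elim (proj₂ (Sub.emb-cone j p) eq)
    ... | inj₂ (_ , r) = r

    -- If φ (peak j) lay strictly above the last-born sibling s of u = φ (peak i),
    -- it would lie above u, forcing j = i and then u = s, which is last-born.
    sibling≼peak : ∀ i j {y} → y ∈ₗ c (φ (peak i)) → φ (peak j) ≼ y → last (parent (φ (peak i))) ≼ φ (peak j)
    sibling≼peak i j {y} y∈ j≼y with ≼-comparable (proj₁ (∈c⇒between y∈)) j≼y
    ... | inj₁ s≼j = s≼j
    ... | inj₂ j≼s with ≼-uncons j≼s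
    ...   | inj₁ eq = subst (last (parent u) ≼_) (sym eq) here
      where u = φ (peak i)
    ...   | inj₂ (_ , j≼p) with enum-injective j i (comparable-tops (enum-P j) (enum-P i)
                                (inj₁ (≼-trans (subst (φ (peak j) ≼_) (proj₂ sibling) j≼p) (parent-≼ u≢root))))
      where open HasOutArc (hasOutArc y∈)
    ...     | refl = ⊥-elim (not-lastBorn (subst LastBorn (sym u≡s) sibling-lastBorn))
      where
      open HasOutArc (hasOutArc y∈)
      u≡s : φ (peak i) ≡ last (parent (φ (peak i)))
      u≡s with ≼-comparable j≼y (proj₁ (∈c⇒between y∈))
      ... | inj₁ u≼s = ≼-depth-≡ u≼s (sym sibling-depth)
      ... | inj₂ s≼u = sym (≼-depth-≡ s≼u sibling-depth)

    arcs : ∀ p q → Arc g p q ⇔ (φ (emb q) ∈ₗ c (φ (emb p)))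
    arcs (inj₁ i) (inj₁ j) = mk⇔ (λ { (forest eq) → out⇒links i j eq }) (λ l → forest (links⇒out i j l))
    arcs (inj₁ i) (inj₂ (j , q)) = mk⇔ to from
      where
      on-path : Member (sub j) (proj₁ (Sub.members j (bottom (c (φ (peak i)))))) q ⇔
                (φ (Sub.emb j q) ≼ bottom (c (φ (peak i))))
      on-path = proj₂ (Sub.members j (bottom (c (φ (peak i))))) q
      to : Arc g (inj₁ i) (inj₂ (j , q)) → φ (Sub.emb j q) ∈ₗ c (φ (peak i))
      to (cross eq q∈) = between⇒∈c link (≼-trans (proj₁ (∈c⇒between link)) (proj₁ (Sub.emb-cone j q)))
                                         (Equivalence.to on-path q∈)
        where link = out⇒links i j eq
      from : φ (Sub.emb j q) ∈ₗ c (φ (peak i)) → Arc g (inj₁ i) (inj₂ (j , q))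
      from y∈ = cross (links⇒out i j link) (Equivalence.from on-path (proj₂ (∈c⇒between y∈)))
        where
        j≼y : φ (peak j) ≼ φ (Sub.emb j q)
        j≼y = proj₁ (Sub.emb-cone j q)
        link : Links i j
        link = between⇒∈c y∈ (sibling≼peak i j y∈ j≼y) (≼-trans j≼y (proj₂ (∈c⇒between y∈)))
    arcs (inj₂ (j , p)) (inj₁ i) = mk⇔ (λ ()) from
      where
      from : φ (peak i) ∈ₗ c (φ (Sub.emb j p)) → Arc g (inj₂ (j , p)) (inj₁ i)
      from i∈ with ∈c⇒strictly-below-parent i∈
      ... | p≼i , p≢i with enum-injective j i (comparable-tops (enum-P j) (enum-P i) (inj₁ (≼-trans (peak≼parent j p) p≼i)))
      ... | refl = ⊥-elim (p≢i (≼-antisym p≼i (peak≼parent j p)))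
    arcs (inj₂ (j , p)) (inj₂ (j′ , q)) = mk⇔ (λ { (inside pq) → Equivalence.to (Sub.arcs j p q) pq }) from
      where
      from : φ (Sub.emb j′ q) ∈ₗ c (φ (Sub.emb j p)) → Arc g (inj₂ (j , p)) (inj₂ (j′ , q))
      from y∈ with enum-injective j j′ (comparable-tops (enum-P j) (enum-P j′)
                     (≼-comparable (≼-trans (peak≼parent j p) (proj₁ (∈c⇒strictly-below-parent y∈))) (proj₁ (Sub.emb-cone j′ q))))
      ... | refl = inside (Equivalence.from (Sub.arcs j p q) y∈)

    base : ∀ p → InBase g p ⇔ Topmost a (emb p)
    base (inj₁ i) = mk⇔ (λ _ → enum-P i) (λ _ → tt)
    base (inj₂ (j , p)) = mk⇔ (λ ()) (λ tp → top-not-below tp (proj₁ (enum-P j)) (Sub.emb-cone j p))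

    members : ∀ t → Σ (Idx g) λ i → ∀ p → Member g i p ⇔ (φ (emb p) ≼ t)
    members t with any? (λ x → InCone? a x ×-dec (φ x ≼? t))
    ... | no none = inj₁ tt , λ p → mk⇔ (λ ()) (λ p≼t → ⊥-elim (none (emb p , emb-cone p , p≼t)))
    ... | yes (x , cx , x≼t) with topmost-above a t x cx x≼t
    ... | y , ty , y≼t with enum-onto y ty
    ... | i , refl = inj₂ (i , proj₁ (Sub.members i t)) , on-path
      where
      on-path : ∀ p → Member g (inj₂ (i , proj₁ (Sub.members i t))) p ⇔ (φ (emb p) ≼ t)
      on-path (inj₁ j) = mk⇔ (λ { top → y≼t }) from
        where
        from : φ (peak j) ≼ t → Member g (inj₂ (i , proj₁ (Sub.members i t))) (inj₁ j)
        from j≼t with enum-injective j i (comparable-tops (enum-P j) (enum-P i) (≼-comparable j≼t y≼t))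
        ... | refl = top
      on-path (inj₂ (j , q)) = mk⇔ (λ { (below q∈) → Equivalence.to (proj₂ (Sub.members i t) q) q∈ }) from
        where
        from : φ (Sub.emb j q) ≼ t → Member g (inj₂ (i , proj₁ (Sub.members i t))) (inj₂ (j , q))
        from q≼t with enum-injective j i (comparable-tops (enum-P j) (enum-P i)
                        (≼-comparable (≼-trans (proj₁ (Sub.emb-cone j q)) q≼t) y≼t))
        ... | refl = below (Equivalence.from (proj₂ (Sub.members i t) q) q≼t)

    realises : Realises a g
    realises = record
      { emb = emb ; emb-injective = emb-injective ; emb-cone = emb-cone ; emb-onto = emb-onto
      ; arcs = arcs ; base = base ; members = members }

  realise-cone : ∀ k a → ConeBounded a k → Σ (Seq k) (Realises a)
  realise-cone zero a bounded = seq0 , record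
    { emb = λ () ; emb-injective = λ () ; emb-cone = λ () ; arcs = λ () ; base = λ ()
    ; members = λ t → tt , λ ()
    ; emb-onto = λ x cx → ⊥-elim (1+n≰n (bounded (φ x) (x ∷ []) ([] ∷ []) λ { y (here refl) → cx , here })) }
  realise-cone (suc k) a bounded = Extend.g k a bounded (realise-cone k) , Extend.realises k a bounded (realise-cone k)

-- From k-sequential graphs to k-Burling graphs

record Realisation {k} (g : Seq k) : Set₁ where
  field
    N      : Set
    finite : Finite N
    T      : BurlingTreeOn N
  open BurlingTreeOn T
  field
    φ              : Vert g → N
    φ-injective    : ∀ p q → φ p ≡ φ q → p ≡ q
    -- The root is kept free: after grafting it represents the base vertex.
    φ-nonroot      : ∀ p → φ p ≢ root
    root∉c         : ∀ x → ¬ root ∈ₗ c x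
    arcs           : ∀ p q → Arc g p q ⇔ (φ q ∈ₗ c (φ p))
    bounded        : ∀ t xs → Unique xs → (∀ x → x ∈ₗ xs → φ x ≼ t) → length xs ≤ k
    base           : ∀ p → InBase g p ⇔ (∀ q → φ q ≼ φ p → q ≡ p)
    target         : Idx g → N
    target-members : ∀ i p → Member g i p ⇔ (φ p ≼ target i)

realisation₀ : Realisation seq0
realisation₀ = record
  { N = ⊤ ; finite = finite-⊤ ; T = point
  ; φ = λ () ; φ-injective = λ () ; φ-nonroot = λ () ; root∉c = λ x () ; arcs = λ ()
  ; bounded = λ { t [] _ _ → z≤n } ; base = λ () ; target = λ _ → tt ; target-members = λ _ () }
  where
  point : BurlingTreeOn ⊤
  point = record
    { tree = record { root = tt ; parent = λ _ → tt ; depth = λ _ → 0 ; depth-root = refl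
                    ; depth-parent = λ v ne → ⊥-elim (ne refl) }
    ; last = λ _ → tt ; last-child = λ v nl → ⊥-elim (proj₁ (proj₂ nl) refl)
    ; c = λ _ → [] ; c-root = refl ; c-last = λ _ _ → refl ; c-branch = λ v ne _ → ⊥-elim (ne refl) }

data SpineView {R : ℕ} : Fin (suc R) → Set where
  spine-end   : SpineView (fromℕ R)
  spine-inner : (d : Fin R) → SpineView (inject₁ d)

spineView : ∀ {R} (d : Fin (suc R)) → SpineView d
spineView {zero} zero = spine-end
spineView {suc R} zero = spine-inner zero
spineView {suc R} (suc d) with spineView d
... | spine-end = spine-end
... | spine-inner d′ = spine-inner (suc d′)

suc-∸-suc : ∀ R r → r < R → suc (R ∸ suc r) ≡ R ∸ r
suc-∸-suc (suc R) zero _ = refl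
suc-∸-suc (suc R) (suc r) (s≤s r<R) = suc-∸-suc R r r<R

-- The Burling tree of seqS h H sub pick: a spine spine 0 (the root) − … − spine R
-- of last-borns ending in the leaf cap, and for every vertex w of H the tree of
-- sub w grafted as a non-last-born child of the spine vertex hub w.  The hub of w
-- is chosen so that if w → v in H, hub w lies strictly above hub v; the arc from
-- the root of block w then runs down the spine from the last-born child of hub w
-- into block v, ending at the target of the stable set picked for w.
module Graft {k : ℕ} (h : ℕ) (H : InForest h) (sub : Fin h → Seq k)
             (pick : (u v : Fin h) → InForest.out H u ≡ just v → Idx (sub v))
             (sub-realisation : ∀ v → Realisation (sub v)) where
  open InForest H

  module Sub (w : Fin h) where
    open Realisation (sub-realisation w) public
    open BurlingTreeOn T public
    open RootedTreeProperties tree (finite⇒decEq finite) public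
    _≟_ : DecidableEquality N
    _≟_ = finite⇒decEq finite

  R : ℕ
  R = suc (maximum rank)

  rank<R : ∀ v → rank v < R
  rank<R v = s≤s (≤-maximum rank v)

  offset : Fin h → ℕ
  offset v with out v
  ... | just w = suc (rank w)
  ... | nothing = 0

  offset≤rank : ∀ v → offset v ≤ rank v
  offset≤rank v with out v in eq
  ... | just w = rank-dec v w eq
  ... | nothing = z≤n

  hubDepth : Fin h → ℕ
  hubDepth v = R ∸ offset v

  hubIndex : Fin h → Fin (suc R)
  hubIndex v = fromℕ< (s≤s (m∸n≤m R (offset v)))

  toℕ-hubIndex : ∀ v → toℕ (hubIndex v) ≡ hubDepth v
  toℕ-hubIndex v = toℕ-fromℕ< (s≤s (m∸n≤m R (offset v)))

  data Node : Set where
    spine : Fin (suc R) → Node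
    cap   : Node
    block : (w : Fin h) → Sub.N w → Node

  hub : Fin h → Node
  hub v = spine (hubIndex v)

  blockParent : (w : Fin h) (x : Sub.N w) → Dec (x ≡ Sub.root w) → Node
  blockParent w x (yes _) = hub w
  blockParent w x (no _) = block w (Sub.parent w x)

  parentN : Node → Node
  parentN (spine zero) = spine zero
  parentN (spine (suc d)) = spine (inject₁ d)
  parentN cap = spine (fromℕ R)
  parentN (block w x) = blockParent w x (Sub._≟_ w x (Sub.root w))

  parent-blockRoot : ∀ w → parentN (block w (Sub.root w)) ≡ hub w
  parent-blockRoot w with Sub._≟_ w (Sub.root w) (Sub.root w)
  ... | yes _ = refl
  ... | no ne = ⊥-elim (ne refl)

  parent-block : ∀ {w x} → x ≢ Sub.root w → parentN (block w x) ≡ block w (Sub.parent w x)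
  parent-block {w} {x} ne with Sub._≟_ w x (Sub.root w)
  ... | yes e = ⊥-elim (ne e)
  ... | no _ = refl

  depthN : Node → ℕ
  depthN (spine d) = toℕ d
  depthN cap = suc R
  depthN (block w x) = Sub.depth w x + suc (hubDepth w)

  depthN-parent : ∀ v → v ≢ spine zero → depthN v ≡ suc (depthN (parentN v))
  depthN-parent (spine zero) ne = ⊥-elim (ne refl)
  depthN-parent (spine (suc d)) _ = cong suc (sym (toℕ-inject₁ d))
  depthN-parent cap _ = cong suc (sym (toℕ-fromℕ R))
  depthN-parent (block w x) _ with Sub._≟_ w x (Sub.root w)
  ... | yes refl rewrite Sub.depth-root w | toℕ-hubIndex w = refl
  ... | no ne rewrite Sub.depth-parent w x ne = refl

  finiteNode : Finite Node
  finiteNode = finite-↔ flatten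
    (finite-⊎ (finite-⊎ (finite-Fin (suc R)) finite-⊤) (finite-Σ h Sub.N Sub.finite))
    where
    flatten : Node ↔ ((Fin (suc R) ⊎ ⊤) ⊎ Σ (Fin h) Sub.N)
    flatten = mk↔ₛ′ (λ { (spine d) → inj₁ (inj₁ d) ; cap → inj₁ (inj₂ tt) ; (block w x) → inj₂ (w , x) })
                    (λ { (inj₁ (inj₁ d)) → spine d ; (inj₁ (inj₂ _)) → cap ; (inj₂ (w , x)) → block w x })
                    (λ { (inj₁ (inj₁ d)) → refl ; (inj₁ (inj₂ tt)) → refl ; (inj₂ (w , x)) → refl })
                    (λ { (spine d) → refl ; cap → refl ; (block w x) → refl })

  treeN : RootedTreeOn Node
  treeN = record
    { root = spine zero ; parent = parentN ; depth = depthN ; depth-root = refl ; depth-parent = depthN-parent }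

  open Paths treeN
  open RootedTreeProperties treeN (finite⇒decEq finiteNode)

  block≢root : ∀ {w x} → block w x ≢ spine zero
  block≢root ()

  block-≼ : ∀ {w x y} → Sub._≼_ w x y → block w x ≼ block w y
  block-≼ Sub.here = here
  block-≼ {w} {x} (Sub.up ne p) = up block≢root (subst (block w x ≼_) (sym (parent-block ne)) (block-≼ p))

  data InBlockBelow (w : Fin h) (x : Sub.N w) : Node → Set where
    in-block : ∀ {y} → Sub._≼_ w x y → InBlockBelow w x (block w y)

  block-≼-inv : ∀ {w x b} → block w x ≼ b → InBlockBelow w x b
  block-≼-inv here = in-block Sub.here
  block-≼-inv {w} {x} (up {v = b} ne p) = climb b ne (block-≼-inv p)
    where
    climb : ∀ b → b ≢ spine zero → InBlockBelow w x (parentN b) → InBlockBelow w x b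
    climb (spine zero) ne q = ⊥-elim (ne refl)
    climb (spine (suc d)) _ ()
    climb cap _ ()
    climb (block w′ y) _ q with Sub._≟_ w′ y (Sub.root w′)
    climb (block w′ y) _ () | yes _
    climb (block w′ y) _ (in-block r) | no ne = in-block (Sub.up ne r)

  lastSpine : (d : Fin (suc R)) → SpineView d → Node
  lastSpine _ spine-end = cap
  lastSpine _ (spine-inner d) = spine (suc d)

  lastN : Node → Node
  lastN (spine d) = lastSpine d (spineView d)
  lastN cap = cap
  lastN (block w x) = block w (Sub.last w x)

  last-spine : ∀ d → toℕ d < R → Σ (Fin (suc R)) λ d′ → lastN (spine d) ≡ spine d′ × toℕ d′ ≡ suc (toℕ d)
  last-spine d d<R with spineView d
  ... | spine-end = ⊥-elim (<-irrefl (toℕ-fromℕ R) d<R)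
  ... | spine-inner d′ = suc d′ , refl , cong suc (sym (toℕ-inject₁ d′))

  spine-≼ : ∀ n {a} (d : Fin (suc R)) → toℕ d ≡ n → toℕ a ≤ n → spine a ≼ spine d
  spine-≼ n {a} d d≡n a≤n with m≤n⇒m<n∨m≡n a≤n
  ... | inj₂ a≡n = subst (λ z → spine z ≼ spine d) (sym (toℕ-injective (trans a≡n (sym d≡n)))) here
  spine-≼ zero d _ _ | inj₁ ()
  spine-≼ (suc n) zero () _ | inj₁ _
  spine-≼ (suc n) (suc d) d≡n _ | inj₁ (s≤s a≤n) =
    up (λ ()) (spine-≼ n (inject₁ d) (trans (toℕ-inject₁ d) (suc-injective d≡n)) a≤n)

  spine-≼-block : ∀ a w y → toℕ a ≤ hubDepth w → spine a ≼ block w y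
  spine-≼-block a w y a≤ = ≼-trans (≼-trans a≼hub hub≼root) (block-≼ (Sub.root-≼ w y))
    where
    a≼hub : spine a ≼ hub w
    a≼hub = spine-≼ _ (hubIndex w) refl (subst (toℕ a ≤_) (sym (toℕ-hubIndex w)) a≤)
    hub≼root : hub w ≼ block w (Sub.root w)
    hub≼root = up block≢root (subst (hub w ≼_) (sym (parent-blockRoot w)) here)

  offset-link : ∀ v w → out v ≡ just w → offset v ≡ suc (rank w)
  offset-link v w e rewrite e = refl

  hub-above-link : ∀ v w → out v ≡ just w → suc (hubDepth v) ≤ hubDepth w
  hub-above-link v w e rewrite offset-link v w e | suc-∸-suc R (rank w) (rank<R w) =
    ∸-monoʳ-≤ R (offset≤rank w)

  hub<R : ∀ v w → out v ≡ just w → toℕ (hubIndex v) < R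
  hub<R v w e rewrite toℕ-hubIndex v = ≤-trans (hub-above-link v w e) (m∸n≤m R (offset w))

  next-spine≼block : ∀ v w → out v ≡ just w → ∀ y → lastN (hub v) ≼ block w y
  next-spine≼block v w e y with last-spine (hubIndex v) (hub<R v w e)
  ... | d′ , eq , d′≡ = subst (_≼ block w y) (sym eq) (spine-≼-block d′ w y
         (subst (_≤ hubDepth w) (sym (trans d′≡ (cong suc (toℕ-hubIndex v)))) (hub-above-link v w e)))

  next-spine≢root : ∀ v w → out v ≡ just w → lastN (hub v) ≢ spine zero
  next-spine≢root v w e with last-spine (hubIndex v) (hub<R v w e)
  ... | d′ , eq , d′≡ = λ e′ → 0≢1+n (trans (cong depthN (sym (trans (sym eq) e′))) d′≡)

  target-of : ∀ v w → out v ≡ just w → Node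
  target-of v w e = block w (Sub.target w (pick v w e))

  link-branch : ∀ v w (e : out v ≡ just w) →
                Σ (List Node) λ r → Branch (lastN (hub v) ∷ r) × lastOf (lastN (hub v)) r ≡ target-of v w e
  link-branch v w e = ≼⇒branch (next-spine≼block v w e (Sub.target w (pick v w e)))

  cBlockRoot : ∀ v mo → out v ≡ mo → List Node
  cBlockRoot v nothing _ = []
  cBlockRoot v (just w) e = lastN (hub v) ∷ proj₁ (link-branch v w e)

  cBlock : (w : Fin h) (x : Sub.N w) → Dec (x ≡ Sub.root w) → List Node
  cBlock w x (yes _) = cBlockRoot w (out w) refl
  cBlock w x (no _) = map (block w) (Sub.c w x)

  cN : Node → List Node
  cN (spine _) = []
  cN cap = []
  cN (block w x) = cBlock w x (Sub._≟_ w x (Sub.root w))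

  c-blockRoot : ∀ w → cN (block w (Sub.root w)) ≡ cBlockRoot w (out w) refl
  c-blockRoot w with Sub._≟_ w (Sub.root w) (Sub.root w)
  ... | yes _ = refl
  ... | no ne = ⊥-elim (ne refl)

  c-block : ∀ {w x} → x ≢ Sub.root w → cN (block w x) ≡ map (block w) (Sub.c w x)
  c-block {w} {x} ne with Sub._≟_ w x (Sub.root w)
  ... | yes e = ⊥-elim (ne e)
  ... | no _ = refl

  child-block⇐ : ∀ {w x y} → Sub.IsChild w y x → IsChild (block w y) (block w x)
  child-block⇐ {w} (ne , e) = block≢root , trans (parent-block ne) (cong (block w) e)

  child-block⇒ : ∀ u {w x} → parentN u ≡ block w x → Σ (Sub.N w) λ y → u ≡ block w y × Sub.IsChild w y x
  child-block⇒ (spine zero) ()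
  child-block⇒ (spine (suc d)) ()
  child-block⇒ cap ()
  child-block⇒ (block w′ y) e with Sub._≟_ w′ y (Sub.root w′)
  child-block⇒ (block w′ y) () | yes _
  child-block⇒ (block w′ y) refl | no ne = y , refl , ne , refl

  parent≢cap : ∀ u → parentN u ≢ cap
  parent≢cap (spine zero) ()
  parent≢cap (spine (suc d)) ()
  parent≢cap cap ()
  parent≢cap (block w x) with Sub._≟_ w x (Sub.root w)
  ... | yes _ = λ ()
  ... | no _ = λ ()

  last-childN : ∀ v → NonLeaf v → IsChild (lastN v) v
  last-childN (spine d) _ with spineView d
  ... | spine-end = (λ ()) , refl
  ... | spine-inner _ = (λ ()) , refl
  last-childN cap (u , _ , e) = ⊥-elim (parent≢cap u e)
  last-childN (block w x) (u , _ , e) with child-block⇒ u e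
  ... | y , refl , y-child = child-block⇐ (Sub.last-child w x (y , y-child))

  lastSpine≢block : ∀ d {w x} → lastN (spine d) ≢ block w x
  lastSpine≢block d with spineView d
  ... | spine-end = λ ()
  ... | spine-inner _ = λ ()

  block-injective : ∀ {w w′ a b} → block w a ≡ block w′ b → Σ (w ≡ w′) λ { refl → a ≡ b }
  block-injective refl = refl , refl

  c-lastN : ∀ v → (v ≢ spine zero) × (lastN (parentN v) ≡ v) → cN v ≡ []
  c-lastN (spine _) _ = refl
  c-lastN cap _ = refl
  c-lastN (block w x) (_ , e) with Sub._≟_ w x (Sub.root w)
  ... | yes _ = ⊥-elim (lastSpine≢block (hubIndex w) e)
  ... | no ne with block-injective e
  ... | refl , e′ rewrite Sub.c-last w x (ne , e′) = refl

  branch-block : ∀ {w bs} → Sub.Branch w bs → Branch (map (block w) bs)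
  branch-block Sub.empty = empty
  branch-block (Sub.single x) = single _
  branch-block (Sub.step ch b) = step (child-block⇐ ch) (branch-block b)

  c-branchN : ∀ v → v ≢ spine zero → ¬ ((v ≢ spine zero) × (lastN (parentN v) ≡ v)) →
              BranchFrom (lastN (parentN v)) (cN v)
  c-branchN (spine _) _ _ = empty , inj₁ refl
  c-branchN cap _ _ = empty , inj₁ refl
  c-branchN (block w x) _ ¬lastBorn with Sub._≟_ w x (Sub.root w)
  ... | yes refl = rootBranch (out w) refl
    where
    rootBranch : ∀ mo (e : out w ≡ mo) → BranchFrom (lastN (hub w)) (cBlockRoot w mo e)
    rootBranch nothing e = empty , inj₁ refl
    rootBranch (just v) e = proj₁ (proj₂ (link-branch w v e)) , inj₂ (_ , refl)
  ... | no ne with Sub.c-branch w x ne (λ lb → ¬lastBorn (block≢root , cong (block w) (proj₂ lb)))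
  ... | b , inj₁ e = branch-block b , inj₁ (cong (map (block w)) e)
  ... | b , inj₂ (t , e) = branch-block b , inj₂ (map (block w) t , cong (map (block w)) e)

  burlingTreeN : BurlingTreeOn Node
  burlingTreeN = record
    { tree = treeN ; last = lastN ; last-child = last-childN
    ; c = cN ; c-root = refl ; c-last = c-lastN ; c-branch = c-branchN }

  g : Seq (suc k)
  g = seqS h H sub pick

  φN : Vert g → Node
  φN (inj₁ v) = block v (Sub.root v)
  φN (inj₂ (v , p)) = block v (Sub.φ v p)

  φN-injective : ∀ p q → φN p ≡ φN q → p ≡ q
  φN-injective (inj₁ v) (inj₁ v′) e with block-injective e
  ... | refl , _ = refl
  φN-injective (inj₁ v) (inj₂ (v′ , p)) e with block-injective e
  ... | refl , e′ = ⊥-elim (Sub.φ-nonroot v p (sym e′))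
  φN-injective (inj₂ (v , p)) (inj₁ v′) e with block-injective e
  ... | refl , e′ = ⊥-elim (Sub.φ-nonroot v p e′)
  φN-injective (inj₂ (v , p)) (inj₂ (v′ , p′)) e with block-injective e
  ... | refl , e′ = cong (λ z → inj₂ (v , z)) (Sub.φ-injective v p p′ e′)

  root∉cN : ∀ x → ¬ spine zero ∈ₗ cN x
  root∉cN (spine _) ()
  root∉cN cap ()
  root∉cN (block w x) with Sub._≟_ w x (Sub.root w)
  ... | yes refl = root∉cBlockRoot (out w) refl
    where
    root∉cBlockRoot : ∀ mo (e : out w ≡ mo) → ¬ spine zero ∈ₗ cBlockRoot w mo e
    root∉cBlockRoot (just v) e r∈ =
      next-spine≢root w v e (≼-root (proj₁ (branch-∈⇒between (proj₁ (proj₂ (link-branch w v e))) r∈)))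
  ... | no _ = λ r∈ → not-block (∈-map⁻ (block w) r∈)
    where
    not-block : ¬ (Σ (Sub.N w) λ y → y ∈ₗ Sub.c w x × spine zero ≡ block w y)
    not-block (_ , _ , ())

  arcs-blockRoot : ∀ v mo (e : out v ≡ mo) q → Arc g (inj₁ v) q ⇔ (φN q ∈ₗ cBlockRoot v mo e)
  arcs-blockRoot v nothing e q = mk⇔ to (λ ())
    where
    to : Arc g (inj₁ v) q → φN q ∈ₗ []
    to (forest e′) with trans (sym e) e′
    ... | ()
    to (cross e′ _) with trans (sym e) e′
    ... | ()
  arcs-blockRoot v (just w) e q = mk⇔ to from
    where
    br : Branch (lastN (hub v) ∷ proj₁ (link-branch v w e))
    br = proj₁ (proj₂ (link-branch v w e))
    br-end : lastOf (lastN (hub v)) (proj₁ (link-branch v w e)) ≡ target-of v w e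
    br-end = proj₂ (proj₂ (link-branch v w e))
    on-branch : ∀ {z} → z ≼ target-of v w e → lastN (hub v) ≼ z → z ∈ₗ cBlockRoot v (just w) e
    on-branch z≼ ≼z = between⇒branch-∈ br ≼z (subst (_ ≼_) (sym br-end) z≼)
    to : Arc g (inj₁ v) q → φN q ∈ₗ cBlockRoot v (just w) e
    to (forest e′) with just-injective (trans (sym e′) e)
    ... | refl = on-branch (block-≼ (Sub.root-≼ w _)) (next-spine≼block v w e _)
    to (cross {x = q′} e′ q∈) with just-injective (trans (sym e′) e)
    ... | refl with uip e′ e
    ... | refl = on-branch (block-≼ (Equivalence.to (Sub.target-members w _ q′) q∈)) (next-spine≼block v w e _)
    from : φN q ∈ₗ cBlockRoot v (just w) e → Arc g (inj₁ v) q
    from q∈ = below-target q (subst (_ ≼_) br-end (proj₂ (branch-∈⇒between br q∈)))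
      where
      below-target : ∀ q → φN q ≼ target-of v w e → Arc g (inj₁ v) q
      below-target (inj₁ _) q≼ with block-≼-inv q≼
      ... | in-block _ = forest e
      below-target (inj₂ (_ , q′)) q≼ with block-≼-inv q≼
      ... | in-block r = cross e (Equivalence.from (Sub.target-members w _ q′) r)

  arcs-inner : ∀ v p q → Arc g (inj₂ (v , p)) q ⇔ (φN q ∈ₗ map (block v) (Sub.c v (Sub.φ v p)))
  arcs-inner v p (inj₁ w) = mk⇔ (λ ()) (λ r∈ → ⊥-elim (not-root (∈-map⁻ (block v) r∈)))
    where
    not-root : ¬ (Σ (Sub.N v) λ y → y ∈ₗ Sub.c v (Sub.φ v p) × block w (Sub.root w) ≡ block v y)
    not-root (y , y∈ , e) with block-injective e
    ... | refl , e′ = Sub.root∉c v (Sub.φ v p) (subst (_∈ₗ Sub.c v (Sub.φ v p)) (sym e′) y∈)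
  arcs-inner v p (inj₂ (w , q)) = mk⇔ to from
    where
    to : Arc g (inj₂ (v , p)) (inj₂ (w , q)) → block w (Sub.φ w q) ∈ₗ map (block v) (Sub.c v (Sub.φ v p))
    to (inside pq) = ∈-map⁺ (block v) (Equivalence.to (Sub.arcs v p q) pq)
    from : block w (Sub.φ w q) ∈ₗ map (block v) (Sub.c v (Sub.φ v p)) → Arc g (inj₂ (v , p)) (inj₂ (w , q))
    from q∈ with ∈-map⁻ (block v) q∈
    ... | y , y∈ , e with block-injective e
    ... | refl , e′ = inside (Equivalence.from (Sub.arcs v p q) (subst (_∈ₗ Sub.c v (Sub.φ v p)) (sym e′) y∈))

  arcsN : ∀ p q → Arc g p q ⇔ (φN q ∈ₗ cN (φN p))
  arcsN (inj₁ v) q rewrite c-blockRoot v = arcs-blockRoot v (out v) refl q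
  arcsN (inj₂ (v , p)) q rewrite c-block (Sub.φ-nonroot v p) = arcs-inner v p q

  not-below-spine : ∀ x d → ¬ φN x ≼ spine d
  not-below-spine (inj₁ _) d x≼ with block-≼-inv x≼
  ... | ()
  not-below-spine (inj₂ _) d x≼ with block-≼-inv x≼
  ... | ()

  not-below-cap : ∀ x → ¬ φN x ≼ cap
  not-below-cap (inj₁ _) x≼ with block-≼-inv x≼
  ... | ()
  not-below-cap (inj₂ _) x≼ with block-≼-inv x≼
  ... | ()

  -- The bound grows by one: a branch meets block w in at most its root and a
  -- branch of sub w.
  record BlockCount (w : Fin h) (y : Sub.N w) (xs : List (Vert g)) : Set where
    field
      inner        : List (Vert (sub w))
      inner-unique : Unique inner
      inner-below  : ∀ q → q ∈ₗ inner → Sub._≼_ w (Sub.φ w q) y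
      inner-∈      : ∀ q → q ∈ₗ inner → inj₂ (w , q) ∈ₗ xs
      length≤      : length xs ≤ suc (length inner)
      length≤-root∉ : ¬ inj₁ w ∈ₗ xs → length xs ≤ length inner

  blockCount : ∀ w y xs → Unique xs → (∀ x → x ∈ₗ xs → φN x ≼ block w y) → BlockCount w y xs
  blockCount w y [] _ _ = record
    { inner = [] ; inner-unique = [] ; inner-below = λ _ () ; inner-∈ = λ _ ()
    ; length≤ = z≤n ; length≤-root∉ = λ _ → z≤n }
  blockCount w y (inj₁ _ ∷ xs) (x∉ ∷ u) under
    with block-≼-inv (under _ (here refl)) | blockCount w y xs u (λ z z∈ → under z (there z∈))
  ... | in-block _ | C = record
    { inner = inner ; inner-unique = inner-unique ; inner-below = inner-below
    ; inner-∈ = λ q q∈ → there (inner-∈ q q∈)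
    ; length≤ = s≤s (length≤-root∉ (λ r∈ → lookup x∉ r∈ refl))
    ; length≤-root∉ = λ r∉ → ⊥-elim (r∉ (here refl)) }
    where open BlockCount C
  blockCount w y (inj₂ (_ , q) ∷ xs) (x∉ ∷ u) under
    with block-≼-inv (under _ (here refl)) | blockCount w y xs u (λ z z∈ → under z (there z∈))
  ... | in-block q≼y | C = record
    { inner = q ∷ inner ; inner-unique = q∉ ∷ inner-unique ; inner-below = below′ ; inner-∈ = ∈′
    ; length≤ = s≤s length≤ ; length≤-root∉ = λ r∉ → s≤s (length≤-root∉ (λ r∈ → r∉ (there r∈))) }
    where
    open BlockCount C
    q∉ : All (q ≢_) inner
    q∉ = tabulate λ {q′} q′∈ e → lookup x∉ (inner-∈ q′ q′∈) (cong (λ z → inj₂ (w , z)) e)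
    below′ : ∀ q′ → q′ ∈ₗ q ∷ inner → Sub._≼_ w (Sub.φ w q′) y
    below′ q′ (here refl) = q≼y
    below′ q′ (there q′∈) = inner-below q′ q′∈
    ∈′ : ∀ q′ → q′ ∈ₗ q ∷ inner → inj₂ (w , q′) ∈ₗ inj₂ (w , q) ∷ xs
    ∈′ q′ (here refl) = here refl
    ∈′ q′ (there q′∈) = there (inner-∈ q′ q′∈)

  boundedN : ∀ t xs → Unique xs → (∀ x → x ∈ₗ xs → φN x ≼ t) → length xs ≤ suc k
  boundedN t [] _ _ = z≤n
  boundedN (spine d) (x ∷ xs) _ under = ⊥-elim (not-below-spine x d (under x (here refl)))
  boundedN cap (x ∷ xs) _ under = ⊥-elim (not-below-cap x (under x (here refl)))
  boundedN (block w y) xs u under = ≤-trans length≤ (s≤s (Sub.bounded w y inner inner-unique inner-below))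
    where open BlockCount (blockCount w y xs u under)

  baseN : ∀ p → InBase g p ⇔ (∀ q → φN q ≼ φN p → q ≡ p)
  baseN (inj₁ v) = mk⇔ (λ _ → highest) (λ _ → tt)
    where
    highest : ∀ q → φN q ≼ φN (inj₁ v) → q ≡ inj₁ v
    highest (inj₁ w) q≼ with block-≼-inv q≼
    ... | in-block _ = refl
    highest (inj₂ (w , q)) q≼ with block-≼-inv q≼
    ... | in-block r = ⊥-elim (Sub.φ-nonroot w q (Sub.≼-root w r))
  baseN (inj₂ (v , p)) = mk⇔ (λ ()) (λ highest → root≢inner (highest (inj₁ v) (block-≼ (Sub.root-≼ v _))))
    where
    root≢inner : inj₁ v ≢ inj₂ (v , p)
    root≢inner ()

  targetN : Idx g → Node
  targetN (inj₁ _) = spine zero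
  targetN (inj₂ (v , i)) = block v (Sub.target v i)

  target-membersN : ∀ i p → Member g i p ⇔ (φN p ≼ targetN i)
  target-membersN (inj₁ tt) p = mk⇔ (λ ()) (λ p≼ → ⊥-elim (not-below-spine p zero p≼))
  target-membersN (inj₂ (v , i)) (inj₁ w) = mk⇔ (λ { top → block-≼ (Sub.root-≼ v _) }) from
    where
    from : φN (inj₁ w) ≼ targetN (inj₂ (v , i)) → Member g (inj₂ (v , i)) (inj₁ w)
    from w≼ with block-≼-inv w≼
    ... | in-block _ = top
  target-membersN (inj₂ (v , i)) (inj₂ (w , q)) =
    mk⇔ (λ { (below q∈) → block-≼ (Equivalence.to (Sub.target-members v i q) q∈) }) from
    where
    from : φN (inj₂ (w , q)) ≼ targetN (inj₂ (v , i)) → Member g (inj₂ (v , i)) (inj₂ (w , q))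
    from q≼ with block-≼-inv q≼
    ... | in-block r = below (Equivalence.from (Sub.target-members v i q) r)

  realisation : Realisation g
  realisation = record
    { N = Node ; finite = finiteNode ; T = burlingTreeN
    ; φ = φN ; φ-injective = φN-injective ; φ-nonroot = φN-nonroot ; root∉c = root∉cN ; arcs = arcsN
    ; bounded = boundedN ; base = baseN ; target = targetN ; target-members = target-membersN }
    where
    φN-nonroot : ∀ p → φN p ≢ spine zero
    φN-nonroot (inj₁ _) ()
    φN-nonroot (inj₂ _) ()

realise : ∀ {k} (g : Seq k) → Realisation g
realise seq0 = realisation₀
realise (seqS h H sub pick) = Graft.realisation h H sub pick (λ v → realise (sub v))

burling⇒sequential : ∀ k {n} (G : OGraph n) (S : Subset n) → KBurlingWithTop k G S → KSequentialWithBase k G S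
burling⇒sequential k {n} G S K = g , ψ , arcsG , baseG
  where
  open KBurlingWithTop K
  open FromFin B
  open BurlingTreeOn burlingTree using (root; c; _≼_)
  open RootedTreeProperties rootedTree _≟ᶠ_ using (root-≼; ≼⇒branch; between⇒branch-∈)
  open BurlingToSequential burlingTree φ φ-inj

  whole-bounded : ConeBounded nothing k
  whole-bounded t xs u under with ≼⇒branch (root-≼ t)
  ... | r , br , eq = bounded (root ∷ r) (branch⇐ br) xs u
    (λ x x∈ → between⇒branch-∈ br (root-≼ _) (subst (φ x ≼_) (sym eq) (proj₂ (under x x∈))))

  g : Seq k
  g = proj₁ (realise-cone k nothing whole-bounded)
  open Realises (proj₂ (realise-cone k nothing whole-bounded))

  vertex : Fin n → Vert g
  vertex x = proj₁ (emb-onto x tt)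

  emb-vertex : ∀ x → emb (vertex x) ≡ x
  emb-vertex x = proj₂ (emb-onto x tt)

  ψ : Fin n ↔ Vert g
  ψ = mk↔ₛ′ vertex emb (λ p → emb-injective _ _ (emb-vertex (emb p))) emb-vertex

  arcsG : ∀ u v → (OGraph.arc G u v ≡ true) ⇔ Arc g (vertex u) (vertex v)
  arcsG u v = mk⇔
    (λ uv → Equivalence.from (arcs (vertex u) (vertex v))
              (subst₂ (λ x y → φ y ∈ₗ c (φ x)) (sym (emb-vertex u)) (sym (emb-vertex v)) (Equivalence.to (induced u v) uv)))
    (λ uv → Equivalence.from (induced u v)
              (subst₂ (λ x y → φ y ∈ₗ c (φ x)) (emb-vertex u) (emb-vertex v) (Equivalence.to (arcs (vertex u) (vertex v)) uv)))

  baseG : ∀ u → (u ∈ S) ⇔ InBase g (vertex u)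
  baseG u = mk⇔
    (λ u∈S → Equivalence.from (base (vertex u)) (subst (Topmost nothing) (sym (emb-vertex u))
               (tt , λ y _ y≼u → Equivalence.to (topset u) u∈S y (≼⇐ y≼u))))
    (λ u-base → Equivalence.from (topset u)
               (λ y y≼u → proj₂ (subst (Topmost nothing) (emb-vertex u) (Equivalence.to (base (vertex u)) u-base)) y tt (≼⇒ y≼u)))

sequential⇒burling : ∀ k {n} (G : OGraph n) (S : Subset n) → KSequentialWithBase k G S → KBurlingWithTop k G S
sequential⇒burling k {n} G S (g , ψ , arcsG , baseG) = record
  { m = size ; B = burlingTree ; φ = φ ; φ-inj = λ e → ψ-injective (φ-injective _ _ (to-injective e))
  ; induced = induced ; bounded = bounded′ ; topset = topset }
  where
  open Realisation (realise g) renaming (φ to φᵍ; bounded to boundedᵍ)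
  open BurlingTreeOn T using (c; _≼_)
  open ToFin finite T
  open Inverse ψ using () renaming (to to ψ→; from to ψ←)

  φ : Fin n → Fin size
  φ x = to (φᵍ (ψ→ x))

  ψ-injective : ∀ {x y} → ψ→ x ≡ ψ→ y → x ≡ y
  ψ-injective = ↔-injective ψ

  induced : ∀ u v → (OGraph.arc G u v ≡ true) ⇔ (φ v ∈ₗ BurlingTree.c burlingTree (φ u))
  induced u v = mk⇔
    (λ uv → arc⇐ (Equivalence.to (arcs (ψ→ u) (ψ→ v)) (Equivalence.to (arcsG u v) uv)))
    (λ uv → Equivalence.from (arcsG u v) (Equivalence.from (arcs (ψ→ u) (ψ→ v)) (arc⇒ uv)))

  bounded′ : ∀ bs → D.Branch (BurlingTree.tree burlingTree) bs → ∀ (xs : List (Fin n)) → Unique xs →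
             (∀ x → x ∈ₗ xs → φ x ∈ₗ bs) → length xs ≤ k
  bounded′ [] _ [] _ _ = z≤n
  bounded′ [] _ (x ∷ xs) _ on with on x (here refl)
  ... | ()
  bounded′ (s ∷ r) br xs u on =
    subst (_≤ k) (length-map ψ→ xs) (boundedᵍ (from (lastOf s r)) (map ψ→ xs) (Unique-map⁺ ψ-injective u) under)
    where
    module Back = FromFin burlingTree
    open RootedTreeProperties Back.rootedTree _≟ᶠ_ using (branch-∈⇒between)
    under : ∀ q → q ∈ₗ map ψ→ xs → φᵍ q ≼ from (lastOf s r)
    under q q∈ with ∈-map⁻ ψ→ q∈
    ... | x , x∈ , refl = subst (_≼ from (lastOf s r)) (strictlyInverseʳ _)
      (≼⇒ (Back.≼⇐ (proj₂ (branch-∈⇒between (Back.branch⇒ br) (on x x∈)))))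

  topset : ∀ x → (x ∈ S) ⇔ (∀ y → D._≼_ (BurlingTree.tree burlingTree) (φ y) (φ x) → y ≡ x)
  topset x = mk⇔
    (λ x∈S y y≼x → ψ-injective (Equivalence.to (base (ψ→ x)) (Equivalence.to (baseG x) x∈S) (ψ→ y)
                      (subst₂ _≼_ (strictlyInverseʳ _) (strictlyInverseʳ _) (≼⇒ y≼x))))
    (λ highest → Equivalence.from (baseG x) (Equivalence.from (base (ψ→ x)) λ q q≼x →
       trans (sym (Inverse.strictlyInverseˡ ψ q)) (cong ψ→ (highest (ψ← q)
         (subst (λ z → D._≼_ rootedTree (to (φᵍ z)) (φ x)) (sym (Inverse.strictlyInverseˡ ψ q)) (≼⇐ q≼x))))))

lemma4p4 : (k n : ℕ) (G : OGraph n) (S : Subset n) →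
           KBurlingWithTop k G S ⇔ KSequentialWithBase k G S
lemma4p4 k n G S = mk⇔ (burling⇒sequential k G S) (sequential⇒burling k G S)
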